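{- Let $n \ge k > p > 0$ be integers. Then $$\binom{n}{p}^k \le \binom{n}{k}^p \binom{k}{p}^k.$$ -}

module Defs where

module Submission where

-- For fixed 0 < p ≤ k put  R(n) = (n C p)^k / (n C k)^p  for n ≥ k.
-- At n = k we have R(k) = (k C p)^k, so the theorem says that R is
-- non-increasing in n.  The absorption identities
--   (n+1-p) · ((n+1) C p) = (n+1) · (n C p),   (n+1-k) · ((n+1) C k) = (n+1) · (n C k)
-- give  R(n+1) / R(n) = (n+1)^k (n+1-k)^p / ((n+1-p)^k (n+1)^p),  and this is ≤ 1
-- by the weighted AM-GM inequality  x^(k-p) · t^p ≤ s^k,  where s = x - p is the
-- weighted mean of x = n+1 (weight k-p) and t = x - k (weight p).

open import Defs
open import Data.Nat using (ℕ; _≤_; _<_; _*_; _^_)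
open import Data.Nat.Combinatorics using (_C_)
open import Data.Nat using (NonZero; zero; suc; _+_; _∸_)
open import Data.Nat.Properties
open import Data.Nat.Combinatorics using (nCn≡1; nC1≡n; nCk+nC[k+1]≡[n+1]C[k+1])
open import Data.Nat.Tactic.RingSolver using (solve-∀)
open import Relation.Binary.PropositionalEquality

^-distribʳ-* : ∀ x y n → (x * y) ^ n ≡ x ^ n * y ^ n
^-distribʳ-* x y zero    = refl
^-distribʳ-* x y (suc n) = begin
  x * y * (x * y) ^ n       ≡⟨ cong (x * y *_) (^-distribʳ-* x y n) ⟩
  x * y * (x ^ n * y ^ n)   ≡⟨ interchange x y (x ^ n) (y ^ n) ⟩
  x * x ^ n * (y * y ^ n)   ∎
  where
  open ≡-Reasoning
  interchange : ∀ a b c d → a * b * (c * d) ≡ a * c * (b * d)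
  interchange = solve-∀

absorption : ∀ n q → suc q * (suc n C suc q) ≡ suc n * (n C q)
absorption zero    zero    = refl
absorption zero    (suc q) = *-zeroʳ q
absorption (suc n) zero    = begin
  suc (suc n) C 1 + 0   ≡⟨ cong (_+ 0) (nC1≡n (suc (suc n))) ⟩
  suc (suc n) + 0       ≡⟨ +-comm (suc (suc n)) 0 ⟩
  suc (suc n)           ≡⟨ *-identityʳ (suc (suc n)) ⟨
  suc (suc n) * 1       ∎
  where open ≡-Reasoning
absorption (suc n) (suc q) = begin
  suc (suc q) * (suc (suc n) C suc (suc q))
    ≡⟨ cong (suc (suc q) *_) (pascal (suc n) (suc q)) ⟨
  suc (suc q) * (X + Y)
    ≡⟨ split q X Y ⟩
  X + suc q * X + suc (suc q) * Y
    ≡⟨ cong₂ (λ u v → X + u + v) (absorption n q) (absorption n (suc q)) ⟩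
  X + suc n * (n C q) + suc n * (n C suc q)
    ≡⟨ +-assoc X (suc n * (n C q)) (suc n * (n C suc q)) ⟩
  X + (suc n * (n C q) + suc n * (n C suc q))
    ≡⟨ cong (X +_) (*-distribˡ-+ (suc n) (n C q) (n C suc q)) ⟨
  X + suc n * (n C q + n C suc q)
    ≡⟨ cong (λ w → X + suc n * w) (pascal n q) ⟩
  X + suc n * X
    ∎
  where
  open ≡-Reasoning
  pascal = nCk+nC[k+1]≡[n+1]C[k+1]
  X = suc n C suc q
  Y = suc n C suc (suc q)
  split : ∀ q X Y → suc (suc q) * (X + Y) ≡ X + suc q * X + suc (suc q) * Y
  split = solve-∀

-- Complementary absorption:  (n+1-p) · ((n+1) C p) = (n+1) · (n C p),
-- with n+1-p written as any s such that s + p = n+1.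
complement-absorption : ∀ n p s → s + p ≡ suc n → s * (suc n C p) ≡ suc n * (n C p)
complement-absorption n zero    s s+0≡n+1 =
  cong (_* 1) (trans (sym (+-identityʳ s)) s+0≡n+1)
complement-absorption n (suc q) s s+p≡n+1 =
  +-cancelʳ-≡ (suc q * X) (s * X) (suc n * (n C suc q)) (begin
    s * X + suc q * X                        ≡⟨ *-distribʳ-+ X s (suc q) ⟨
    (s + suc q) * X                          ≡⟨ cong (_* X) s+p≡n+1 ⟩
    suc n * X                                ≡⟨ cong (suc n *_) (nCk+nC[k+1]≡[n+1]C[k+1] n q) ⟨
    suc n * (n C q + n C suc q)              ≡⟨ *-distribˡ-+ (suc n) (n C q) (n C suc q) ⟩
    suc n * (n C q) + suc n * (n C suc q)    ≡⟨ cong (_+ suc n * (n C suc q)) (absorption n q) ⟨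
    suc q * X + suc n * (n C suc q)          ≡⟨ +-comm (suc q * X) (suc n * (n C suc q)) ⟩
    suc n * (n C suc q) + suc q * X          ∎)
  where
  open ≡-Reasoning
  X = suc n C suc q

-- Bernoulli-type bound  ((z+1)/z)^d ≤ (a+d)/a  for a + d ≤ z, cleared of
-- denominators.  Each factor (z+1)/z is traded for (a+1)/a, which raises a by one.
bernoulli : ∀ d a z → a + d ≤ z → suc z ^ d * a ≤ (a + d) * z ^ d
bernoulli zero    a z _ = ≤-reflexive (sym (*-identityʳ (a + 0)))
bernoulli (suc d) a z a+d+1≤z = begin
  suc z * suc z ^ d * a           ≡⟨ rearrange (suc z) (suc z ^ d) a ⟩
  suc z ^ d * (suc z * a)         ≤⟨ *-monoʳ-≤ (suc z ^ d) one-factor ⟩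
  suc z ^ d * (z * suc a)         ≡⟨ swap (suc z ^ d) z (suc a) ⟩
  z * (suc z ^ d * suc a)         ≤⟨ *-monoʳ-≤ z (bernoulli d (suc a) z (subst (_≤ z) (+-suc a d) a+d+1≤z)) ⟩
  z * ((suc a + d) * z ^ d)       ≡⟨ cong (λ w → z * (w * z ^ d)) (+-suc a d) ⟨
  z * ((a + suc d) * z ^ d)       ≡⟨ swap z (a + suc d) (z ^ d) ⟩
  (a + suc d) * (z * z ^ d)       ∎
  where
  open ≤-Reasoning
  -- (z+1) · a ≤ z · (a+1), i.e. a ≤ z
  one-factor : suc z * a ≤ z * suc a
  one-factor = subst (suc z * a ≤_) (sym (*-suc z a))
                 (+-monoˡ-≤ (z * a) (≤-trans (m≤m+n a (suc d)) a+d+1≤z))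
  rearrange : ∀ x y w → x * y * w ≡ y * (x * w)
  rearrange = solve-∀
  swap : ∀ x y w → x * (y * w) ≡ y * (x * w)
  swap = solve-∀

-- Weighted AM-GM: a + d is the mean of a + d + e (weight d) and a (weight e), so
--   (a + d + e)^d · a^e ≤ (a + d)^(d + e).
weighted-am-gm : ∀ a d e → (a + d + e) ^ d * a ^ e ≤ (a + d) ^ (d + e)
weighted-am-gm a d zero = ≤-reflexive (begin
  (a + d + 0) ^ d * 1   ≡⟨ *-identityʳ _ ⟩
  (a + d + 0) ^ d       ≡⟨ cong (λ w → w ^ d) (+-identityʳ (a + d)) ⟩
  (a + d) ^ d           ≡⟨ cong ((a + d) ^_) (+-identityʳ d) ⟨
  (a + d) ^ (d + 0)     ∎)
  where open ≡-Reasoning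
weighted-am-gm a d (suc e) = begin
  (a + d + suc e) ^ d * (a * a ^ e)   ≡⟨ cong (λ w → w ^ d * (a * a ^ e)) (+-suc (a + d) e) ⟩
  suc z ^ d * (a * a ^ e)             ≡⟨ *-assoc (suc z ^ d) a (a ^ e) ⟨
  suc z ^ d * a * a ^ e               ≤⟨ *-monoˡ-≤ (a ^ e) (bernoulli d a z (m≤m+n (a + d) e)) ⟩
  (a + d) * z ^ d * a ^ e             ≡⟨ *-assoc (a + d) (z ^ d) (a ^ e) ⟩
  (a + d) * (z ^ d * a ^ e)           ≤⟨ *-monoʳ-≤ (a + d) (weighted-am-gm a d e) ⟩
  (a + d) * (a + d) ^ (d + e)         ≡⟨ cong ((a + d) ^_) (+-suc d e) ⟨
  (a + d) ^ (d + suc e)               ∎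
  where
  open ≤-Reasoning
  z = a + d + e

am-gm-step : ∀ a d e → a ^ e * (a + d + e) ^ (d + e) ≤ (a + d) ^ (d + e) * (a + d + e) ^ e
am-gm-step a d e = begin
  a ^ e * x ^ (d + e)           ≡⟨ cong (a ^ e *_) (^-distribˡ-+-* x d e) ⟩
  a ^ e * (x ^ d * x ^ e)       ≡⟨ rearrange (a ^ e) (x ^ d) (x ^ e) ⟩
  x ^ d * a ^ e * x ^ e         ≤⟨ *-monoˡ-≤ (x ^ e) (weighted-am-gm a d e) ⟩
  (a + d) ^ (d + e) * x ^ e     ∎
  where
  open ≤-Reasoning
  x = a + d + e
  rearrange : ∀ u v w → u * (v * w) ≡ v * u * w
  rearrange = solve-∀

transfer : ∀ k p s t x A A' B B' c .{{_ : NonZero s}} .{{_ : NonZero t}} →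
           s * A' ≡ x * A → t * B' ≡ x * B → t ^ p * x ^ k ≤ s ^ k * x ^ p →
           A ^ k ≤ B ^ p * c ^ k → A' ^ k ≤ B' ^ p * c ^ k
transfer k p s t x A A' B B' c sA'≡xA tB'≡xB ratio bound =
  *-cancelˡ-≤ (s ^ k * t ^ p) {{m*n≢0 (s ^ k) (t ^ p) {{m^n≢0 s k}} {{m^n≢0 t p}}}} (begin
    s ^ k * t ^ p * A' ^ k               ≡⟨ regroup₁ (s ^ k) (t ^ p) (A' ^ k) ⟩
    t ^ p * (s ^ k * A' ^ k)             ≡⟨ cong (t ^ p *_) (^-distribʳ-* s A' k) ⟨
    t ^ p * (s * A') ^ k                 ≡⟨ cong (λ w → t ^ p * w ^ k) sA'≡xA ⟩
    t ^ p * (x * A) ^ k                  ≡⟨ cong (t ^ p *_) (^-distribʳ-* x A k) ⟩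
    t ^ p * (x ^ k * A ^ k)              ≡⟨ *-assoc (t ^ p) (x ^ k) (A ^ k) ⟨
    t ^ p * x ^ k * A ^ k                ≤⟨ *-monoʳ-≤ (t ^ p * x ^ k) bound ⟩
    t ^ p * x ^ k * (B ^ p * c ^ k)      ≤⟨ *-monoˡ-≤ (B ^ p * c ^ k) ratio ⟩
    s ^ k * x ^ p * (B ^ p * c ^ k)      ≡⟨ regroup₂ (s ^ k) (x ^ p) (B ^ p) (c ^ k) ⟩
    s ^ k * (x ^ p * B ^ p * c ^ k)      ≡⟨ cong (λ w → s ^ k * (w * c ^ k)) (^-distribʳ-* x B p) ⟨
    s ^ k * ((x * B) ^ p * c ^ k)        ≡⟨ cong (λ w → s ^ k * (w ^ p * c ^ k)) tB'≡xB ⟨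
    s ^ k * ((t * B') ^ p * c ^ k)       ≡⟨ cong (λ w → s ^ k * (w * c ^ k)) (^-distribʳ-* t B' p) ⟩
    s ^ k * (t ^ p * B' ^ p * c ^ k)     ≡⟨ regroup₂ (s ^ k) (t ^ p) (B' ^ p) (c ^ k) ⟨
    s ^ k * t ^ p * (B' ^ p * c ^ k)     ∎)
  where
  open ≤-Reasoning
  regroup₁ : ∀ a b w → a * b * w ≡ b * (a * w)
  regroup₁ = solve-∀
  regroup₂ : ∀ a b u v → a * b * (u * v) ≡ a * (b * u * v)
  regroup₂ = solve-∀

-- The base case
-- n = k is an equality since k C k = 1; the step n ↦ n + 1 is `transfer` with
-- s = n+1-p = m+1+d, t = n+1-k = m+1 and x = n+1.
binomial-power-bound : ∀ d p m → let k = d + p; n = m + k in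
                       (n C p) ^ k ≤ (n C k) ^ p * (k C p) ^ k
binomial-power-bound d p zero
  rewrite nCn≡1 (d + p) | ^-zeroˡ p | *-identityˡ (((d + p) C p) ^ (d + p)) = ≤-refl
binomial-power-bound d p (suc m) =
  transfer k p (suc m + d) (suc m) (suc n) (n C p) (suc n C p) (n C k) (suc n C k) (k C p)
    (complement-absorption n p (suc m + d) s+p≡n+1)
    (complement-absorption n k (suc m) refl)
    (subst (λ x → suc m ^ p * x ^ k ≤ (suc m + d) ^ k * x ^ p) s+p≡n+1 (am-gm-step (suc m) d p))
    (binomial-power-bound d p m)
  where
  k = d + p
  n = m + k
  s+p≡n+1 : suc m + d + p ≡ suc n
  s+p≡n+1 = cong suc (+-assoc m d p)

-- The theorem: instantiate with m = n - k and d = k - p.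
lemma2p9 : ∀ (n k p : ℕ) → k ≤ n → p < k → 0 < p → (n C p) ^ k ≤ (n C k) ^ p * (k C p) ^ k
lemma2p9 n k p k≤n p<k _ =
  subst (λ N → (N C p) ^ k ≤ (N C k) ^ p * (k C p) ^ k) (m∸n+n≡m k≤n)
    (subst (λ K → ((n ∸ k + K) C p) ^ K ≤ ((n ∸ k + K) C K) ^ p * (K C p) ^ K) (m∸n+n≡m (<⇒≤ p<k))
      (binomial-power-bound (k ∸ p) p (n ∸ k)))
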